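{- Let $q=2^s$ and $q_0=2^h$ with $h\ge1$ and $2h<s$, let $\bar q=q/q_0$ and $n_1=\bar q/q_0$. Then the set $$\bar A=\{t_1(q+q_0)+t_2(q+\bar q)+t_3(q(n_1-1)+\bar q+1)\;:\;0\le t_1\le n_1-1,\ 0\le t_2\le q_0-1,\ 0\le t_3\le q_0-1\}$$ is a complete set of representatives for the congruence classes of $\mathbb Z$ modulo $q$. -}

module Defs where

open import Data.Nat using (ℕ; _+_; _*_; _∸_; _^_)
open import Data.Integer as ℤ using (ℤ)
open import Data.Integer.Divisibility using (_∣_)

-- Parameters: q = 2^s, q₀ = 2^h, q̄ = q / q₀ = 2^(s-h), n₁ = q̄ / q₀ = 2^(s-2h)
-- (exact powers of two since 2h < s).
q : ℕ → ℕ
q s = 2 ^ s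

q₀ : ℕ → ℕ
q₀ h = 2 ^ h

qbar : ℕ → ℕ → ℕ
qbar s h = 2 ^ (s ∸ h)

n₁ : ℕ → ℕ → ℕ
n₁ s h = 2 ^ (s ∸ (h + h))

-- The element t₁(q+q₀) + t₂(q+q̄) + t₃(q(n₁-1)+q̄+1) of Ā (n₁ ≥ 2, so n₁ ∸ 1 is exact).
elemA : ℕ → ℕ → ℕ → ℕ → ℕ → ℕ
elemA s h t₁ t₂ t₃ =
  t₁ * (q s + q₀ h) + t₂ * (q s + qbar s h)
  + t₃ * (q s * (n₁ s h ∸ 1) + qbar s h + 1)

CongMod : ℕ → ℤ → ℤ → Set
CongMod m x y = ℤ.+ m ∣ (x ℤ.- y)

-- Since 2h < s we have q̄ = n₁ q₀ and q = q₀ (n₁ q₀), and q (n₁ − 1) ≡ 0 (mod q), so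
--   t₁(q+q₀) + t₂(q+q̄) + t₃(q(n₁−1)+q̄+1) ≡ t₃ + q₀ (t₁ + n₁ ((t₂ + t₃) mod q₀))   (mod q).
-- The right-hand side is a mixed-radix numeral with digits t₃ < q₀, t₁ < n₁ and
-- (t₂ + t₃) mod q₀ < q₀, and the shear (t₂, t₃) ↦ ((t₂ + t₃) mod q₀, t₃) permutes (ℤ/q₀)².
module Submission where

open import Data.Nat
open import Data.Nat.Properties
open import Data.Nat.DivMod
open import Data.Nat.Divisibility using (divides; m∣m*n) renaming (_∣_ to _∣ℕ_)
open import Data.Integer as ℤ using (ℤ; +_; _%ℕ_; _/ℕ_)
import Data.Integer.Properties as ℤ
import Data.Integer.DivMod as ℤ
import Data.Integer.Tactic.RingSolver as ℤ-Solver
open import Data.Nat.Tactic.RingSolver using (solve-∀)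
open import Data.Product using (_×_; ∃-syntax; _,_)
open import Data.Sum using (inj₁; inj₂)
open import Relation.Binary.PropositionalEquality
open import Defs

∣∸⇒%≡ : ∀ {m n o} .{{_ : NonZero m}} → o ≤ n → m ∣ℕ n ∸ o → n % m ≡ o % m
∣∸⇒%≡ {m} {n} {o} o≤n m∣n∸o = begin
  n % m             ≡⟨ cong (_% m) (m∸n+n≡m o≤n) ⟨
  (n ∸ o + o) % m   ≡⟨ %-remove-+ˡ o m∣n∸o ⟩
  o % m             ∎
  where open ≡-Reasoning

congMod⇒%≡ : ∀ m a b .{{_ : NonZero m}} → CongMod m (+ a) (+ b) → a % m ≡ b % m
congMod⇒%≡ m a b m∣a-b with m∣a⊖b ← subst (m ∣ℕ_) (cong ℤ.∣_∣ (ℤ.m-n≡m⊖n a b)) m∣a-b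
                          | ≤-total a b
... | inj₁ a≤b = sym (∣∸⇒%≡ a≤b (subst (m ∣ℕ_) (ℤ.∣⊖∣-≤ a≤b) m∣a⊖b))
... | inj₂ b≤a = ∣∸⇒%≡ b≤a (subst (m ∣ℕ_) (trans (ℤ.∣m⊖n∣≡∣n⊖m∣ a b) (ℤ.∣⊖∣-≤ b≤a)) m∣a⊖b)

%≡%ℕ⇒congMod : ∀ m x a .{{_ : NonZero m}} → a % m ≡ x %ℕ m → CongMod m x (+ a)
%≡%ℕ⇒congMod m x a a%m≡x%m = divides ℤ.∣ x /ℕ m ℤ.- + a /ℕ m ∣ (begin
  ℤ.∣ x ℤ.- + a ∣
    ≡⟨ cong₂ (λ y z → ℤ.∣ y ℤ.- z ∣) (ℤ.a≡a%ℕn+[a/ℕn]*n x m) (ℤ.a≡a%ℕn+[a/ℕn]*n (+ a) m) ⟩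
  ℤ.∣ (+ (x %ℕ m) ℤ.+ x /ℕ m ℤ.* + m) ℤ.- (+ (a % m) ℤ.+ + a /ℕ m ℤ.* + m) ∣
    ≡⟨ cong (λ r → ℤ.∣ (+ (x %ℕ m) ℤ.+ x /ℕ m ℤ.* + m) ℤ.- (+ r ℤ.+ + a /ℕ m ℤ.* + m) ∣) a%m≡x%m ⟩
  ℤ.∣ (+ (x %ℕ m) ℤ.+ x /ℕ m ℤ.* + m) ℤ.- (+ (x %ℕ m) ℤ.+ + a /ℕ m ℤ.* + m) ∣
    ≡⟨ cong ℤ.∣_∣ (common-remainder (+ (x %ℕ m)) (x /ℕ m) (+ a /ℕ m) (+ m)) ⟩
  ℤ.∣ (x /ℕ m ℤ.- + a /ℕ m) ℤ.* + m ∣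
    ≡⟨ ℤ.abs-* (x /ℕ m ℤ.- + a /ℕ m) (+ m) ⟩
  ℤ.∣ x /ℕ m ℤ.- + a /ℕ m ∣ * m ∎)
  where
  open ≡-Reasoning
  common-remainder : ∀ r u v w → (r ℤ.+ u ℤ.* w) ℤ.- (r ℤ.+ v ℤ.* w) ≡ (u ℤ.- v) ℤ.* w
  common-remainder = ℤ-Solver.solve-∀

x+b*y<b*c : ∀ {b c x y} → x < b → y < c → x + b * y < b * c
x+b*y<b*c {b} {c} {x} {y} x<b y<c = begin-strict
  x + b * y   <⟨ +-monoˡ-< (b * y) x<b ⟩
  b + b * y   ≡⟨ *-suc b y ⟨
  b * suc y   ≤⟨ *-monoʳ-≤ b y<c ⟩
  b * c       ∎
  where open ≤-Reasoning

x+b*y-injective : ∀ {b x y x′ y′} .{{_ : NonZero b}} → x < b → x′ < b →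
                  x + b * y ≡ x′ + b * y′ → x ≡ x′ × y ≡ y′
x+b*y-injective {b} {x} {y} {x′} {y′} x<b x′<b eq =
  x≡x′ , *-cancelˡ-≡ y y′ b (+-cancelˡ-≡ x _ _ (trans eq (cong (_+ b * y′) (sym x≡x′))))
  where
  [x+b*y]%b≡x : ∀ {x} y → x < b → (x + b * y) % b ≡ x
  [x+b*y]%b≡x {x} y x<b = trans (cong (λ z → (x + z) % b) (*-comm b y))
                                (trans ([m+kn]%n≡m%n x y b) (m<n⇒m%n≡m x<b))
  x≡x′ : x ≡ x′
  x≡x′ = trans (sym ([x+b*y]%b≡x y x<b)) (trans (cong (_% b) eq) ([x+b*y]%b≡x y′ x′<b))

x+b*y-surjective : ∀ {b c n} .{{_ : NonZero b}} → n < b * c →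
                   ∃[ x ] ∃[ y ] (x < b × y < c × x + b * y ≡ n)
x+b*y-surjective {b} {c} {n} n<b*c =
  n % b , n / b , m%n<n n b , m<n*o⇒m/o<n (subst (n <_) (*-comm b c) n<b*c) ,
  trans (cong (_+_ (n % b)) (*-comm b (n / b))) (sym (m≡m%n+[m/n]*n n b))

[[m+t]%n+u]%n≡m : ∀ {m n t u} .{{_ : NonZero n}} → t + u ≡ n → m < n → ((m + t) % n + u) % n ≡ m
[[m+t]%n+u]%n≡m {m} {n} {t} {u} t+u≡n m<n = begin
  ((m + t) % n + u) % n         ≡⟨ %-distribˡ-+ ((m + t) % n) u n ⟩
  ((m + t) % n % n + u % n) % n ≡⟨ cong (λ z → (z + u % n) % n) (m%n%n≡m%n (m + t) n) ⟩
  ((m + t) % n + u % n) % n     ≡⟨ %-distribˡ-+ (m + t) u n ⟨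
  (m + t + u) % n               ≡⟨ cong (_% n) (trans (+-assoc m t u) (cong (_+_ m) t+u≡n)) ⟩
  (m + n) % n                   ≡⟨ [m+n]%n≡m%n m n ⟩
  m % n                         ≡⟨ m<n⇒m%n≡m m<n ⟩
  m                             ∎
  where open ≡-Reasoning

Covers : (m b₁ b₂ b₃ : ℕ) → (ℕ → ℕ → ℕ → ℕ) → Set
Covers m b₁ b₂ b₃ f =
  (x : ℤ) → ∃[ t₁ ] ∃[ t₂ ] ∃[ t₃ ] (t₁ < b₁ × t₂ < b₂ × t₃ < b₃ × CongMod m x (+ f t₁ t₂ t₃))

Separates : (m b₁ b₂ b₃ : ℕ) → (ℕ → ℕ → ℕ → ℕ) → Set
Separates m b₁ b₂ b₃ f =
  (t₁ t₂ t₃ u₁ u₂ u₃ : ℕ) → t₁ < b₁ → t₂ < b₂ → t₃ < b₃ → u₁ < b₁ → u₂ < b₂ → u₃ < b₃ →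
  CongMod m (+ f t₁ t₂ t₃) (+ f u₁ u₂ u₃) → t₁ ≡ u₁ × t₂ ≡ u₂ × t₃ ≡ u₃

IsCompleteResidueSystem : (m b₁ b₂ b₃ : ℕ) → (ℕ → ℕ → ℕ → ℕ) → Set
IsCompleteResidueSystem m b₁ b₂ b₃ f = Covers m b₁ b₂ b₃ f × Separates m b₁ b₂ b₃ f

completeResidueSystem-via : ∀ m .{{_ : NonZero m}} {b₁ b₂ b₃} (f r : ℕ → ℕ → ℕ → ℕ) →
  (∀ {t₁ t₂ t₃} → t₁ < b₁ → t₂ < b₂ → t₃ < b₃ → f t₁ t₂ t₃ % m ≡ r t₁ t₂ t₃) →
  (∀ {n} → n < m → ∃[ t₁ ] ∃[ t₂ ] ∃[ t₃ ] (t₁ < b₁ × t₂ < b₂ × t₃ < b₃ × r t₁ t₂ t₃ ≡ n)) →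
  (∀ {t₁ t₂ t₃ u₁ u₂ u₃} → t₁ < b₁ → t₂ < b₂ → t₃ < b₃ → u₁ < b₁ → u₂ < b₂ → u₃ < b₃ →
     r t₁ t₂ t₃ ≡ r u₁ u₂ u₃ → t₁ ≡ u₁ × t₂ ≡ u₂ × t₃ ≡ u₃) →
  IsCompleteResidueSystem m b₁ b₂ b₃ f
completeResidueSystem-via m {b₁} {b₂} {b₃} f r f%m≡r r-surjective r-injective = covers , separates
  where
  covers : Covers m b₁ b₂ b₃ f
  covers x with r-surjective (ℤ.n%ℕd<d x m)
  ... | t₁ , t₂ , t₃ , t₁< , t₂< , t₃< , r≡x%m =
    t₁ , t₂ , t₃ , t₁< , t₂< , t₃< , %≡%ℕ⇒congMod m x _ (trans (f%m≡r t₁< t₂< t₃<) r≡x%m)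
  separates : Separates m b₁ b₂ b₃ f
  separates t₁ t₂ t₃ u₁ u₂ u₃ t₁< t₂< t₃< u₁< u₂< u₃< f≡f = r-injective t₁< t₂< t₃< u₁< u₂< u₃<
    (trans (sym (f%m≡r t₁< t₂< t₃<)) (trans (congMod⇒%≡ m _ _ f≡f) (f%m≡r u₁< u₂< u₃<)))

element : (Q Q₀ Q̄ N : ℕ) → ℕ → ℕ → ℕ → ℕ
element Q Q₀ Q̄ N t₁ t₂ t₃ = t₁ * (Q + Q₀) + t₂ * (Q + Q̄) + t₃ * (Q * (N ∸ 1) + Q̄ + 1)

residue : (Q₀ N : ℕ) .{{_ : NonZero Q₀}} → ℕ → ℕ → ℕ → ℕ
residue Q₀ N t₁ t₂ t₃ = t₃ + Q₀ * (t₁ + N * ((t₂ + t₃) % Q₀))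

element≡residue+multiple : ∀ Q₀ N .{{_ : NonZero Q₀}} .{{_ : NonZero N}} t₁ t₂ t₃ →
  element (Q₀ * (N * Q₀)) Q₀ (N * Q₀) N t₁ t₂ t₃
  ≡ residue Q₀ N t₁ t₂ t₃ + Q₀ * (N * Q₀) * (t₁ + t₂ + t₃ * (N ∸ 1) + (t₂ + t₃) / Q₀)
element≡residue+multiple Q₀ N@(suc n) t₁ t₂ t₃ = begin
  element (Q₀ * (N * Q₀)) Q₀ (N * Q₀) N t₁ t₂ t₃
    ≡⟨ expand t₁ t₂ t₃ n Q₀ ⟩
  t₃ + Q₀ * t₁ + (t₂ + t₃) * (N * Q₀) + Q₀ * (N * Q₀) * (t₁ + t₂ + t₃ * n)
    ≡⟨ cong (λ z → t₃ + Q₀ * t₁ + z * (N * Q₀) + Q₀ * (N * Q₀) * (t₁ + t₂ + t₃ * n))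
            (m≡m%n+[m/n]*n (t₂ + t₃) Q₀) ⟩
  t₃ + Q₀ * t₁ + ((t₂ + t₃) % Q₀ + (t₂ + t₃) / Q₀ * Q₀) * (N * Q₀)
     + Q₀ * (N * Q₀) * (t₁ + t₂ + t₃ * n)
    ≡⟨ regroup t₁ t₂ t₃ n Q₀ ((t₂ + t₃) % Q₀) ((t₂ + t₃) / Q₀) ⟩
  residue Q₀ N t₁ t₂ t₃ + Q₀ * (N * Q₀) * (t₁ + t₂ + t₃ * n + (t₂ + t₃) / Q₀) ∎
  where
  open ≡-Reasoning
  expand : ∀ t₁ t₂ t₃ n Q₀ →
    t₁ * (Q₀ * (suc n * Q₀) + Q₀) + t₂ * (Q₀ * (suc n * Q₀) + suc n * Q₀)
    + t₃ * (Q₀ * (suc n * Q₀) * n + suc n * Q₀ + 1)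
    ≡ t₃ + Q₀ * t₁ + (t₂ + t₃) * (suc n * Q₀) + Q₀ * (suc n * Q₀) * (t₁ + t₂ + t₃ * n)
  expand = solve-∀
  regroup : ∀ t₁ t₂ t₃ n Q₀ j d →
    t₃ + Q₀ * t₁ + (j + d * Q₀) * (suc n * Q₀) + Q₀ * (suc n * Q₀) * (t₁ + t₂ + t₃ * n)
    ≡ t₃ + Q₀ * (t₁ + suc n * j) + Q₀ * (suc n * Q₀) * (t₁ + t₂ + t₃ * n + d)
  regroup = solve-∀

module _ (Q₀ N : ℕ) .{{Q₀≢0 : NonZero Q₀}} .{{_ : NonZero N}} where

  private instance
    Q-nonZero : NonZero (Q₀ * (N * Q₀))
    Q-nonZero = m*n≢0 Q₀ (N * Q₀) {{Q₀≢0}} {{m*n≢0 N Q₀}}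

  residue<Q : ∀ {t₁ t₂ t₃} → t₁ < N → t₃ < Q₀ → residue Q₀ N t₁ t₂ t₃ < Q₀ * (N * Q₀)
  residue<Q {t₂ = t₂} {t₃} t₁<N t₃<Q₀ = x+b*y<b*c t₃<Q₀ (x+b*y<b*c t₁<N (m%n<n (t₂ + t₃) Q₀))

  element%Q≡residue : ∀ {t₁ t₂ t₃} → t₁ < N → t₂ < Q₀ → t₃ < Q₀ →
    element (Q₀ * (N * Q₀)) Q₀ (N * Q₀) N t₁ t₂ t₃ % (Q₀ * (N * Q₀)) ≡ residue Q₀ N t₁ t₂ t₃
  element%Q≡residue {t₁} {t₂} {t₃} t₁<N _ t₃<Q₀ = begin
    element Q Q₀ (N * Q₀) N t₁ t₂ t₃ % Q      ≡⟨ cong (_% Q) (element≡residue+multiple Q₀ N t₁ t₂ t₃) ⟩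
    (residue Q₀ N t₁ t₂ t₃ + Q * carry) % Q   ≡⟨ %-remove-+ʳ _ (m∣m*n {Q} carry) ⟩
    residue Q₀ N t₁ t₂ t₃ % Q                 ≡⟨ m<n⇒m%n≡m (residue<Q t₁<N t₃<Q₀) ⟩
    residue Q₀ N t₁ t₂ t₃                     ∎
    where
    open ≡-Reasoning
    Q = Q₀ * (N * Q₀)
    carry = t₁ + t₂ + t₃ * (N ∸ 1) + (t₂ + t₃) / Q₀

  residue-surjective : ∀ {n} → n < Q₀ * (N * Q₀) →
    ∃[ t₁ ] ∃[ t₂ ] ∃[ t₃ ] (t₁ < N × t₂ < Q₀ × t₃ < Q₀ × residue Q₀ N t₁ t₂ t₃ ≡ n)
  residue-surjective {n} n<Q with x+b*y-surjective {Q₀} n<Q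
  ... | t₃ , a , t₃<Q₀ , a<NQ₀ , t₃+Q₀a≡n with x+b*y-surjective {N} a<NQ₀
  ... | t₁ , j , t₁<N , j<Q₀ , t₁+Nj≡a = t₁ , t₂ , t₃ , t₁<N , m%n<n _ Q₀ , t₃<Q₀ , (begin
    t₃ + Q₀ * (t₁ + N * ((t₂ + t₃) % Q₀)) ≡⟨ cong (λ z → t₃ + Q₀ * (t₁ + N * z)) [t₂+t₃]%Q₀≡j ⟩
    t₃ + Q₀ * (t₁ + N * j)                ≡⟨ cong (λ z → t₃ + Q₀ * z) t₁+Nj≡a ⟩
    t₃ + Q₀ * a                           ≡⟨ t₃+Q₀a≡n ⟩
    n                                     ∎)
    where
    open ≡-Reasoning
    t₂ = (j + (Q₀ ∸ t₃)) % Q₀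
    [t₂+t₃]%Q₀≡j : (t₂ + t₃) % Q₀ ≡ j
    [t₂+t₃]%Q₀≡j = [[m+t]%n+u]%n≡m (m∸n+n≡m (<⇒≤ t₃<Q₀)) j<Q₀

  residue-injective : ∀ {t₁ t₂ t₃ u₁ u₂ u₃} →
    t₁ < N → t₂ < Q₀ → t₃ < Q₀ → u₁ < N → u₂ < Q₀ → u₃ < Q₀ →
    residue Q₀ N t₁ t₂ t₃ ≡ residue Q₀ N u₁ u₂ u₃ → t₁ ≡ u₁ × t₂ ≡ u₂ × t₃ ≡ u₃
  residue-injective {t₂ = t₂} {t₃} {u₂ = u₂} t₁<N t₂<Q₀ t₃<Q₀ u₁<N u₂<Q₀ u₃<Q₀ eq
    with x+b*y-injective t₃<Q₀ u₃<Q₀ eq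
  ... | refl , eq′ with x+b*y-injective t₁<N u₁<N eq′
  ... | refl , shears≡ = refl , (begin
    t₂                                     ≡⟨ unshear t₂<Q₀ ⟨
    ((t₂ + t₃) % Q₀ + (Q₀ ∸ t₃)) % Q₀      ≡⟨ cong (λ z → (z + (Q₀ ∸ t₃)) % Q₀) shears≡ ⟩
    ((u₂ + t₃) % Q₀ + (Q₀ ∸ t₃)) % Q₀      ≡⟨ unshear u₂<Q₀ ⟩
    u₂                                     ∎) , refl
    where
    open ≡-Reasoning
    unshear : ∀ {a} → a < Q₀ → ((a + t₃) % Q₀ + (Q₀ ∸ t₃)) % Q₀ ≡ a
    unshear = [[m+t]%n+u]%n≡m (m+[n∸m]≡n (<⇒≤ t₃<Q₀))

  completeResidueSystem : ∀ {Q Q̄} → Q ≡ Q₀ * (N * Q₀) → Q̄ ≡ N * Q₀ →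
    IsCompleteResidueSystem Q N Q₀ Q₀ (element Q Q₀ Q̄ N)
  completeResidueSystem refl refl = completeResidueSystem-via (Q₀ * (N * Q₀))
    (element (Q₀ * (N * Q₀)) Q₀ (N * Q₀) N) (residue Q₀ N)
    element%Q≡residue residue-surjective residue-injective

s∸h≡s∸[h+h]+h : ∀ {s} h → h + h ≤ s → s ∸ h ≡ s ∸ (h + h) + h
s∸h≡s∸[h+h]+h {s} h h+h≤s = begin
  s ∸ h           ≡⟨ m∸n+n≡m (m+n≤o⇒m≤o∸n h h+h≤s) ⟨
  s ∸ h ∸ h + h   ≡⟨ cong (_+ h) (∸-+-assoc s h h) ⟩
  s ∸ (h + h) + h ∎
  where open ≡-Reasoning

qbar≡n₁*q₀ : ∀ {s} h → h + h ≤ s → qbar s h ≡ n₁ s h * q₀ h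
qbar≡n₁*q₀ {s} h h+h≤s =
  trans (cong (2 ^_) (s∸h≡s∸[h+h]+h h h+h≤s)) (^-distribˡ-+-* 2 (s ∸ (h + h)) h)

q≡q₀*qbar : ∀ {s h} → h ≤ s → q s ≡ q₀ h * qbar s h
q≡q₀*qbar {s} {h} h≤s = trans (cong (2 ^_) (sym (m+[n∸m]≡n h≤s))) (^-distribˡ-+-* 2 h (s ∸ h))

mainTheorem3 : (s h : ℕ) → 1 ≤ h → h Data.Nat.+ h < s →
    ((x : ℤ) → ∃[ t₁ ] ∃[ t₂ ] ∃[ t₃ ] (t₁ < n₁ s h × t₂ < q₀ h × t₃ < q₀ h × CongMod (q s) x (+ elemA s h t₁ t₂ t₃)))
    × ((t₁ t₂ t₃ u₁ u₂ u₃ : ℕ) → t₁ < n₁ s h → t₂ < q₀ h → t₃ < q₀ h → u₁ < n₁ s h → u₂ < q₀ h → u₃ < q₀ h → CongMod (q s) (+ elemA s h t₁ t₂ t₃) (+ elemA s h u₁ u₂ u₃) → (t₁ ≡ u₁ × t₂ ≡ u₂ × t₃ ≡ u₃))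
mainTheorem3 s h _ h+h<s =
  completeResidueSystem (q₀ h) (n₁ s h) {{m^n≢0 2 h}} {{m^n≢0 2 (s ∸ (h + h))}}
    (trans (q≡q₀*qbar (m+n≤o⇒m≤o h h+h≤s)) (cong (q₀ h *_) (qbar≡n₁*q₀ h h+h≤s)))
    (qbar≡n₁*q₀ h h+h≤s)
  where
  h+h≤s : h + h ≤ s
  h+h≤s = <⇒≤ h+h<s
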